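{- Let $G$ and $H$ be finite nonempty connected graphs each having at least one edge, $f\colon G\to H$ a graph homomorphism, $v\in V(G)$, $w=f(v)$, $\Gamma=\pi_1^2(G,v)$, universal 2-coverings $p_G\colon(\tilde G,\tilde v)\to(G,v)$, $p_H\colon(\tilde H,\tilde w)\to(H,w)$, and $\tilde f$ the based lift of $f$. Let $\tilde g\in\mathrm{Hom}^\Gamma(\tilde G,\tilde H)_{\tilde f}$ satisfy $\pi(\tilde g)=f$. Then there is $\varpi\in\pi_1^2(H,w)$ such that $\tilde g=\varpi\tilde f$.
   Context: Graphs allow loops; $N(x)$ neighborhood, $N^2(x)=\bigcup_{y\in N(x)}N(y)$. $\pi_1^2(G,v)$: group of classes of closed walks at $v$ under the equivalence generated by (A) $(x_0,\dots,x_m)\sim(x_0,\dots,x_k,y,x_k,\dots,x_m)$, $y$ adjacent to $x_k$, and (B) equal-length walks differing in at most one position. A 2-covering map restricts to bijections $N(x)\to N(p(x))$, $N^2(x)\to N^2(p(x))$; the universal 2-covering is the connected based 2-covering with trivial 2-fundamental group. $\pi_1^2(H,w)$ acts on $\tilde H$: for $g=[\gamma]$ and a walk $\varphi$ from $\tilde w$ to $\tilde y$, $g\tilde y$ is the endpoint of the lift from $\tilde w$ of $\gamma\cdot(p_H\circ\varphi)$; similarly $\Gamma$ acts on $\tilde G$, and on $\tilde H$ via $f_*$. $\tilde f$ is the based homomorphism with $p_H\circ\tilde f=f\circ p_G$; $\varpi\tilde f$ denotes $\tilde x\mapsto\varpi(\tilde f(\tilde x))$. Multi-homomorphisms $\eta\colon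 V(A)\to\mathcal{P}(V(B))\setminus\{\emptyset\}$ with $\eta(x)\times\eta(y)\subseteq E(B)$ for edges $(x,y)$, forming the poset $\mathrm{Hom}(A,B)$ under pointwise inclusion (topologized by the order complex); graph homomorphisms are identified with singleton-valued ones. $\mathrm{Hom}^\Gamma(\tilde G,\tilde H)$: those $\eta$ with $\eta(g\tilde x)=f_*(g)\eta(\tilde x)$; $\mathrm{Hom}^\Gamma(\tilde G,\tilde H)_{\tilde f}$ is its component containing $\tilde f$. $\pi\colon\mathrm{Hom}^\Gamma(\tilde G,\tilde H)\to\mathrm{Hom}(G,H)$ is $\pi(\eta)(p_G(\tilde x))=p_H(\eta(\tilde x))$. -}

module Defs where

open import Level using (Level; _⊔_) renaming (suc to lsuc; zero to lzero)
open import Data.Nat using (ℕ)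
open import Data.Fin using (Fin)
open import Data.List using (List; []; _∷_; _++_; map; drop)
open import Data.List.Relation.Unary.Linked using (Linked)
open import Data.Product using (Σ; ∃; ∃-syntax; _×_; _,_)
open import Data.Sum using (_⊎_)
open import Data.Empty using (⊥)
open import Relation.Binary.PropositionalEquality using (_≡_)
open import Relation.Binary.Construct.Closure.Equivalence using (EqClosure)
open import Function.Bundles using (_↔_; _⇔_)

-- Graphs (loops allowed): a vertex type with a symmetric adjacency relation.

record Graph : Set₁ where
  field
    V     : Set
    _~_   : V → V → Set
    ~-sym : ∀ {x y} → x ~ y → y ~ x

open Graph public

module _ (G : Graph) where
  open Graph G renaming (_~_ to _∼_)

  Finite : Set
  Finite = ∃[ n ] (V G ↔ Fin n)

  Nonempty : Set
  Nonempty = V G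

  HasEdge : Set
  HasEdge = ∃[ x ] ∃[ y ] (x ∼ y)

  endpt : V G → List (V G) → V G
  endpt a []       = a
  endpt a (x ∷ xs) = endpt x xs

  IsWalk : V G → V G → List (V G) → Set
  IsWalk a b []       = ⊥
  IsWalk a b (x ∷ xs) = x ≡ a × Linked _∼_ (x ∷ xs) × endpt x xs ≡ b

  Connected : Set
  Connected = ∀ x y → ∃[ s ] IsWalk x y s

  data Move : List (V G) → List (V G) → Set where
    moveA : ∀ pre post x y → x ∼ y →
            Move (pre ++ x ∷ post) (pre ++ x ∷ y ∷ x ∷ post)
    moveB : ∀ pre post x x′ →
            Move (pre ++ x ∷ post) (pre ++ x′ ∷ post)

  Homotopic : V G → V G → List (V G) → List (V G) → Set
  Homotopic a b = EqClosure (λ s t → Move s t × IsWalk a b s × IsWalk a b t)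

  Trivialπ₁² : V G → Set
  Trivialπ₁² a = ∀ s → IsWalk a a s → Homotopic a a s (a ∷ [])

-- concatenation of a walk a→b with a walk b→c
_⊙_ : {A : Set} → List A → List A → List A
s ⊙ t = s ++ drop 1 t

IsHom : (G H : Graph) → (V G → V H) → Set
IsHom G H f = ∀ {x y} → _~_ G x y → _~_ H (f x) (f y)

record Is2Covering (X G : Graph) (p : V X → V G) : Set where
  field
    hom    : IsHom X G p
    N-inj  : ∀ x y y′ → _~_ X x y → _~_ X x y′ → p y ≡ p y′ → y ≡ y′
    N-surj : ∀ x u → _~_ G (p x) u → ∃[ y ] (_~_ X x y × p y ≡ u)
    N²-inj : ∀ x y y′ → (∃[ z ] (_~_ X x z × _~_ X z y)) →
             (∃[ z ] (_~_ X x z × _~_ X z y′)) → p y ≡ p y′ → y ≡ y′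
    N²-surj : ∀ x u → (∃[ t ] (_~_ G (p x) t × _~_ G t u)) →
              ∃[ y ] ((∃[ z ] (_~_ X x z × _~_ X z y)) × p y ≡ u)

record Universal2Covering (G : Graph) (v : V G) : Set₁ where
  field
    cov       : Graph
    base      : V cov
    p         : V cov → V G
    p-base    : p base ≡ v
    covering  : Is2Covering cov G p
    connected : Connected cov
    simply    : Trivialπ₁² cov base

open Universal2Covering public

-- action of a closed walk γ at v (representing a class of π₁²(G,v)) on the
-- universal 2-covering: Act U γ y z  means  γ·y = z, i.e. z is the endpoint
-- of the lift from the base point of γ · (p ∘ φ) for a walk φ from base to y.
Act : {G : Graph} {v : V G} (U : Universal2Covering G v) →
      List (V G) → V (cov U) → V (cov U) → Set
Act {G} U γ y z =
  ∃[ φ ] ∃[ λ′ ] (IsWalk (cov U) (base U) y φ × IsWalk (cov U) (base U) z λ′ ×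
                  map (p U) λ′ ≡ γ ⊙ map (p U) φ)

-- Multi-homomorphisms, with subsets represented as predicates

MultiMap : (A B : Graph) → Set₁
MultiMap A B = V A → V B → Set

IsMultiHom : (A B : Graph) → MultiMap A B → Set
IsMultiHom A B η =
  (∀ x → ∃[ y ] η x y) ×
  (∀ x y a b → _~_ A x y → η x a → η y b → _~_ B a b)

-- pointwise inclusion (the poset order of Hom(A,B))
_⊑_ : {A B : Graph} → MultiMap A B → MultiMap A B → Set
_⊑_ {A} {B} η θ = ∀ x b → η x b → θ x b

-- graph homomorphisms as singleton-valued multi-homomorphisms
singleton : {A B : Graph} → (V A → V B) → MultiMap A B
singleton h x b = b ≡ h x

_≐_ : {A B : Graph} → MultiMap A B → MultiMap A B → Set
_≐_ {A} {B} η θ = ∀ x b → η x b ⇔ θ x b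

-- Hom^Γ(G̃,H̃): Γ-equivariant multi-homomorphisms, η(g x̃) = f_*(g) η(x̃),
-- where Γ = π₁²(G,v) acts on H̃ through f_* [γ] = [f ∘ γ].
module _ {G H : Graph} {v : V G} (f : V G → V H)
         (UG : Universal2Covering G v) (UH : Universal2Covering H (f v)) where

  IsEquivariant : MultiMap (cov UG) (cov UH) → Set
  IsEquivariant η =
    ∀ γ → IsWalk G v v γ → ∀ x x′ → Act UG γ x x′ →
    ∀ z → (η x′ z ⇔ (∃[ y ] (η x y × Act UH (map f γ) y z)))

  InHomΓ : MultiMap (cov UG) (cov UH) → Set
  InHomΓ η = IsMultiHom (cov UG) (cov UH) η × IsEquivariant η

  -- η and θ lie in the same connected component of (the order complex of)
  -- Hom^Γ(G̃,H̃): joined by a zigzag of comparable elements of Hom^Γ.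
  data SameComp : MultiMap (cov UG) (cov UH) → MultiMap (cov UG) (cov UH) → Set₁ where
    done : ∀ {η} → SameComp η η
    step : ∀ {η θ ζ} → InHomΓ θ → (_⊑_ {cov UG} {cov UH} η θ ⊎ _⊑_ {cov UG} {cov UH} θ η) → SameComp θ ζ → SameComp η ζ

  ProjectsTo : MultiMap (cov UG) (cov UH) → Set
  ProjectsTo η = ∀ x y → η x y → p UH y ≡ f (p UG x)

-- A multi-homomorphism g̃ with π(g̃) = f sends each vertex x to vertices adjacent to
-- all of g̃(x′) for a neighbour x′ of x, and these lie over the same vertex of H; so
-- the 2-covering property makes g̃ single-valued, i.e. a homomorphism g with
-- p_H ∘ g = p_H ∘ f̃.  Take ϖ to be the projection of a walk ψ in H̃ from the base
-- point to g(ṽ).  For a walk φ from the base point to f̃(x), lifting ϖ · (p_H ∘ φ)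
-- first retraces ψ and then lifts p_H ∘ φ from g(ṽ).  Choosing φ = f̃ ∘ χ for a walk χ
-- from ṽ to x in G̃, that lift is g ∘ χ and ends at g(x); any other φ with the same
-- endpoints gives the same endpoint, because φ followed by f̃ ∘ χ backwards is null-homotopic
-- in the universal 2-covering and the moves (A) and (B) do not change endpoints of
-- lifts along a 2-covering.
module Submission where

open import Defs
open import Data.List using (List; []; _∷_; _++_; map; drop)
open import Data.List.Properties using (map-++; map-∘; map-cong)
open import Data.List.Relation.Unary.Linked using (Linked; [-]; _∷_)
import Data.List.Relation.Unary.Linked as Linked
open import Data.List.Relation.Unary.Linked.Properties using (map⁺)
open import Data.Product using (∃-syntax; _×_; _,_; proj₁; proj₂)
open import Relation.Binary.PropositionalEquality
open import Relation.Binary.Construct.Closure.ReflexiveTransitive using (ε; _◅_)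
open import Relation.Binary.Construct.Closure.Symmetric using (fwd; bwd)
open import Function.Bundles using (_⇔_; mk⇔)
open import Function.Construct.Composition using (_⇔-∘_)

endpt-++ : (G : Graph) (a : V G) (s t : List (V G)) →
           endpt G a (s ++ t) ≡ endpt G (endpt G a s) t
endpt-++ G a []      t = refl
endpt-++ G a (x ∷ s) t = endpt-++ G x s t

endpt-map : (X G : Graph) (h : V X → V G) (a : V X) (s : List (V X)) →
            endpt G (h a) (map h s) ≡ h (endpt X a s)
endpt-map X G h a []      = refl
endpt-map X G h a (x ∷ s) = endpt-map X G h x s

linked-map : (X G : Graph) (h : V X → V G) → IsHom X G h → ∀ {s} →
             Linked (_~_ X) s → Linked (_~_ G) (map h s)
linked-map X G h h-hom l = map⁺ (Linked.map h-hom l)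

linked-++ : (G : Graph) (a : V G) (s t : List (V G)) → Linked (_~_ G) (a ∷ s) →
            Linked (_~_ G) (endpt G a s ∷ t) → Linked (_~_ G) (a ∷ s ++ t)
linked-++ G a []      t _         l = l
linked-++ G a (x ∷ s) t (a~x ∷ l) l′ = a~x ∷ linked-++ G x s t l l′

walk-map : (X G : Graph) (h : V X → V G) → IsHom X G h → ∀ {a b φ} →
           IsWalk X a b φ → IsWalk G (h a) (h b) (map h φ)
walk-map X G h h-hom {φ = x ∷ s} (refl , l , refl) =
  refl , linked-map X G h h-hom l , endpt-map X G h x s

walk-++ : (G : Graph) → ∀ {a b c x y s t} → IsWalk G a b (x ∷ s) →
          IsWalk G b c (y ∷ t) → IsWalk G a c (x ∷ s ++ t)
walk-++ G {x = x} {s = s} {t} (refl , l , refl) (refl , l′ , refl) =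
  refl , linked-++ G x s t l l′ , endpt-++ G x s t

-- The walk x ∷ s traversed backwards is endpt x s ∷ reverseTail x s.
reverseTail : {A : Set} → A → List A → List A
reverseTail x []       = []
reverseTail x (y ∷ ys) = reverseTail y ys ++ x ∷ []

endpt-reverseTail : (G : Graph) (x : V G) (s : List (V G)) →
                    endpt G (endpt G x s) (reverseTail x s) ≡ x
endpt-reverseTail G x []      = refl
endpt-reverseTail G x (y ∷ s) =
  trans (endpt-++ G (endpt G y s) (reverseTail y s) (x ∷ [])) refl

linked-reverseTail : (G : Graph) (x : V G) (s : List (V G)) → Linked (_~_ G) (x ∷ s) →
                     Linked (_~_ G) (endpt G x s ∷ reverseTail x s)
linked-reverseTail G x []      _         = [-]
linked-reverseTail G x (y ∷ s) (x~y ∷ l) =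
  linked-++ G (endpt G y s) (reverseTail y s) (x ∷ []) (linked-reverseTail G y s l)
    (subst (λ z → Linked (_~_ G) (z ∷ x ∷ [])) (sym (endpt-reverseTail G y s))
           (~-sym G x~y ∷ [-]))

map-reverseTail : {A B : Set} (h : A → B) (x : A) (s : List A) →
                  map h (reverseTail x s) ≡ reverseTail (h x) (map h s)
map-reverseTail h x []      = refl
map-reverseTail h x (y ∷ s) =
  trans (map-++ h (reverseTail y s) (x ∷ [])) (cong (_++ h x ∷ []) (map-reverseTail h y s))

walk-reverse : (G : Graph) → ∀ {a b x s} → IsWalk G a b (x ∷ s) →
               IsWalk G b a (endpt G x s ∷ reverseTail x s)
walk-reverse G {x = x} {s} (refl , l , refl) =
  refl , linked-reverseTail G x s l , endpt-reverseTail G x s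

has-neighbour : (G : Graph) → Connected G → HasEdge G → ∀ x → ∃[ y ] _~_ G x y
has-neighbour G conn (u , u′ , u~u′) x with conn x u
... | (_ ∷ [])    , refl , _         , refl = u′ , u~u′
... | (_ ∷ y ∷ _) , refl , x~y ∷ _ , _    = y , x~y

covering-has-neighbour : {X G : Graph} {q : V X → V G} → Is2Covering X G q →
                         (∀ u → ∃[ u′ ] _~_ G u u′) → ∀ x → ∃[ y ] _~_ X x y
covering-has-neighbour C nbr x with nbr _
... | u′ , r with Is2Covering.N-surj C x u′ r
...   | y , x~y , _ = y , x~y

multiHom-injective-on-fibres : {A X G : Graph} {q : V X → V G} → Is2Covering X G q →
  (η : MultiMap A X) → IsMultiHom A X η → ∀ {x x′} → _~_ A x x′ →
  ∀ {a a′} → η x a → η x a′ → q a ≡ q a′ → a ≡ a′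
multiHom-injective-on-fibres {X = X} C η (nonempty , adjacent) {x} {x′} x~x′ ηa ηa′ =
  Is2Covering.N-inj C b _ _ (~-sym X (adjacent x x′ _ b x~x′ ηa ηb))
                            (~-sym X (adjacent x x′ _ b x~x′ ηa′ ηb))
  where
  b : V X
  b = proj₁ (nonempty x′)
  ηb : η x′ b
  ηb = proj₂ (nonempty x′)

module Lifting {X G : Graph} {p : V X → V G} (C : Is2Covering X G p) where
  open Is2Covering C

  -- Lift u s e: the walk p u ∷ s of G lifts to a walk of X starting at u and ending at e.
  data Lift (u : V X) : List (V G) → V X → Set where
    stop : Lift u [] u
    step : ∀ {y ys ỹ e} → _~_ X u ỹ → p ỹ ≡ y → Lift ỹ ys e → Lift u (y ∷ ys) e

  lift-unique : ∀ {u s e₁ e₂} → Lift u s e₁ → Lift u s e₂ → e₁ ≡ e₂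
  lift-unique stop stop = refl
  lift-unique {u} (step r py l) (step r′ py′ l′) with N-inj u _ _ r r′ (trans py (sym py′))
  ... | refl = lift-unique l l′

  lift-exists : ∀ {u} s → Linked (_~_ G) (p u ∷ s) → ∃[ e ] Lift u s e
  lift-exists []      _ = _ , stop
  lift-exists {u} (y ∷ s) (r ∷ l) with N-surj u y r
  ... | ỹ , u~ỹ , refl with lift-exists s l
  ...   | e , ỹ↝e = e , step u~ỹ refl ỹ↝e

  lift-++ : ∀ {u s t m e} → Lift u s m → Lift m t e → Lift u (s ++ t) e
  lift-++ stop          l′ = l′
  lift-++ (step r py l) l′ = step r py (lift-++ l l′)

  lift-split : ∀ {u} s {t e} → Lift u (s ++ t) e → ∃[ m ] (Lift u s m × Lift m t e)
  lift-split []      l = _ , stop , l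
  lift-split (y ∷ s) (step r py l) with lift-split s l
  ... | m , l₁ , l₂ = m , step r py l₁ , l₂

  lift-endpt : ∀ {u s e} → Lift u s e → p e ≡ endpt G (p u) s
  lift-endpt stop            = refl
  lift-endpt (step _ refl l) = lift-endpt l

  walk-lifts : ∀ {u e φ} → IsWalk X u e φ → Lift u (drop 1 (map p φ)) e
  walk-lifts {φ = u ∷ s} (refl , l , refl) = go u s l
    where
    go : ∀ u s → Linked (_~_ X) (u ∷ s) → Lift u (map p s) (endpt X u s)
    go u []      _         = stop
    go u (y ∷ s) (u~y ∷ l) = step u~y refl (go y s l)

  lift-walk : ∀ {u s e} → Lift u s e → ∃[ φ ] (IsWalk X u e φ × map p φ ≡ p u ∷ s)
  lift-walk {u} stop = u ∷ [] , (refl , [-] , refl) , refl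
  lift-walk {u} (step u~ỹ refl l) with lift-walk l
  ... | ỹ ∷ φ , (refl , lk , e) , eq = u ∷ ỹ ∷ φ , (refl , u~ỹ ∷ lk , e) , cong (p u ∷_) eq

  lift-reverse : ∀ s x {u e} → p u ≡ endpt G x s → Lift u (reverseTail x s) e → Lift e s u
  lift-reverse []      x pu stop = stop
  lift-reverse (y ∷ s) x {u} pu l with lift-split (reverseTail y s) l
  ... | m , u↝m , step m~e _ stop =
    step (~-sym X m~e) pm (lift-reverse s y pu u↝m)
    where
    pm : p m ≡ y
    pm = begin
      p m                                     ≡⟨ lift-endpt u↝m ⟩
      endpt G (p u) (reverseTail y s)         ≡⟨ cong (λ z → endpt G z (reverseTail y s)) pu ⟩
      endpt G (endpt G y s) (reverseTail y s) ≡⟨ endpt-reverseTail G y s ⟩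
      y                                       ∎
      where open ≡-Reasoning

  LiftsAgree : V X → List (V G) → List (V G) → Set
  LiftsAgree u s t = ∀ {e₁ e₂} → Lift u s e₁ → Lift u t e₂ → e₁ ≡ e₂

  agree-++ : ∀ {s t} pre → (∀ {m} → LiftsAgree m s t) → ∀ {u} → LiftsAgree u (pre ++ s) (pre ++ t)
  agree-++ pre agree l₁ l₂ with lift-split pre l₁ | lift-split pre l₂
  ... | m , u↝m , m↝e₁ | m′ , u↝m′ , m′↝e₂ with lift-unique u↝m u↝m′
  ...   | refl = agree m↝e₁ m′↝e₂

  backtrack-agree : ∀ {u x y s} → p u ≡ x → LiftsAgree u s (y ∷ x ∷ s)
  backtrack-agree {u} refl l (step u~ỹ _ (step ỹ~ũ pũ l′))
    with N-inj _ u _ (~-sym X u~ỹ) ỹ~ũ (sym pũ)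
  ... | refl = lift-unique l l′

  spur-agree : ∀ {u x y s} → LiftsAgree u (x ∷ s) (x ∷ y ∷ x ∷ s)
  spur-agree {u} (step r px l) (step r′ px′ l′) with N-inj u _ _ r r′ (trans px (sym px′))
  ... | refl = backtrack-agree px l l′

  -- If the walk continues past the replaced vertex, the two lifts rejoin there by N²-inj.
  swap-agree : ∀ {u x x′ s} → endpt G x s ≡ endpt G x′ s → LiftsAgree u (x ∷ s) (x′ ∷ s)
  swap-agree {u} {s = []} x≡x′ (step r px stop) (step r′ px′ stop) =
    N-inj u _ _ r r′ (trans px (trans x≡x′ (sym px′)))
  swap-agree {u} {s = _ ∷ _} _ (step r _ (step r₁ pw l)) (step r′ _ (step r₂ pw′ l′))
    with N²-inj u _ _ (_ , r , r₁) (_ , r′ , r₂) (trans pw (sym pw′))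
  ... | refl = lift-unique l l′

  move-agree : ∀ {a a′ s t u} → Move G s t → IsWalk G a a′ s → IsWalk G a a′ t →
               p u ≡ a → LiftsAgree u (drop 1 s) (drop 1 t)
  move-agree (moveA []      _ _ _ _) (refl , _) _ pu = backtrack-agree pu
  move-agree (moveA (_ ∷ pre) _ _ _ _) _ _ _ = agree-++ pre spur-agree
  move-agree (moveB []      _ _ _)   _ _ _ = lift-unique
  move-agree (moveB (q ∷ pre) post x x′) (_ , _ , e) (_ , _ , e′) _ =
    agree-++ pre (swap-agree (begin
      endpt G x post                    ≡⟨ sym (endpt-++ G q pre (x ∷ post)) ⟩
      endpt G q (pre ++ x ∷ post)       ≡⟨ trans e (sym e′) ⟩
      endpt G q (pre ++ x′ ∷ post)      ≡⟨ endpt-++ G q pre (x′ ∷ post) ⟩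
      endpt G x′ post                   ∎))
    where open ≡-Reasoning

  walk-tail-lifts : ∀ {a a′ s u} → IsWalk G a a′ s → p u ≡ a → ∃[ e ] Lift u (drop 1 s) e
  walk-tail-lifts {s = _ ∷ s} (refl , l , _) refl = lift-exists s l

  homotopic-agree : ∀ {a a′ s t u} → Homotopic G a a′ s t → p u ≡ a →
                    LiftsAgree u (drop 1 s) (drop 1 t)
  homotopic-agree ε _ = lift-unique
  homotopic-agree (fwd (m , ws , wr) ◅ rest) pu l₁ l₂ with walk-tail-lifts wr pu
  ... | _ , l = trans (move-agree m ws wr pu l₁ l) (homotopic-agree rest pu l l₂)
  homotopic-agree (bwd (m , wr , ws) ◅ rest) pu l₁ l₂ with walk-tail-lifts wr pu
  ... | _ , l = trans (sym (move-agree m wr ws pu l l₁)) (homotopic-agree rest pu l l₂)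

module _ {X G : Graph} (h : V X → V G) (h-hom : IsHom X G h) where

  move-map : ∀ {s t} → Move X s t → Move G (map h s) (map h t)
  move-map (moveA pre post x y r)
    rewrite map-++ h pre (x ∷ post) | map-++ h pre (x ∷ y ∷ x ∷ post) =
    moveA (map h pre) (map h post) (h x) (h y) (h-hom r)
  move-map (moveB pre post x x′)
    rewrite map-++ h pre (x ∷ post) | map-++ h pre (x′ ∷ post) =
    moveB (map h pre) (map h post) (h x) (h x′)

  homotopic-map : ∀ {a b s t} → Homotopic X a b s t → Homotopic G (h a) (h b) (map h s) (map h t)
  homotopic-map ε = ε
  homotopic-map (fwd (m , ws , wt) ◅ rest) =
    fwd (move-map m , walk-map X G h h-hom ws , walk-map X G h h-hom wt) ◅ homotopic-map rest
  homotopic-map (bwd (m , ws , wt) ◅ rest) =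
    bwd (move-map m , walk-map X G h h-hom ws , walk-map X G h h-hom wt) ◅ homotopic-map rest

module UniversalLifting {H : Graph} {w : V H} (U : Universal2Covering H w) where
  open Lifting (covering U)

  private
    X = cov U
    P = p U
    b₀ = base U

  closed-walk-lifts-closed : ∀ {c b e} → IsWalk X b₀ b₀ c → P b ≡ P b₀ →
                             Lift b (drop 1 (map P c)) e → e ≡ b
  closed-walk-lifts-closed wc pb l =
    homotopic-agree (homotopic-map P (Is2Covering.hom (covering U)) (simply U _ wc)) pb l stop

  projections-agree : ∀ {y φ₁ φ₂ b} → IsWalk X b₀ y φ₁ → IsWalk X b₀ y φ₂ → P b ≡ P b₀ →
                      LiftsAgree b (drop 1 (map P φ₁)) (drop 1 (map P φ₂))
  -- The lift from b of the projected null-homotopic closed walk φ₁ · φ̄₂ returns to b,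
  -- so its second half, read backwards, lifts p ∘ φ₂ from b to the end of the lift of p ∘ φ₁.
  projections-agree {φ₁ = _ ∷ T₁} {_ ∷ T₂} {b} w₁@(refl , _ , e₁) w₂@(refl , _ , e₂) pb {z₁} l₁ l₂ =
    lift-unique (lift-reverse (map P T₂) (P b₀) pz₁ z₁↝b) l₂
    where
    R : List (V X)
    R = reverseTail b₀ T₂
    closed : IsWalk X b₀ b₀ (b₀ ∷ T₁ ++ R)
    closed = walk-++ X w₁ (walk-reverse X w₂)
    z₁↝b : Lift z₁ (reverseTail (P b₀) (map P T₂)) b
    z₁↝b with walk-tail-lifts (walk-map X H P (Is2Covering.hom (covering U)) closed) pb
    ... | e , b↝e with closed-walk-lifts-closed closed pb b↝e
                     | lift-split (map P T₁) (subst (λ s → Lift b s e) (map-++ P T₁ R) b↝e)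
    ...   | refl | m , b↝m , m↝b with lift-unique b↝m l₁
    ...     | refl = subst (λ s → Lift m s b) (map-reverseTail P b₀ T₂) m↝b
    pz₁ : P z₁ ≡ endpt H (P b₀) (map P T₂)
    pz₁ = begin
      P z₁                          ≡⟨ lift-endpt l₁ ⟩
      endpt H (P b) (map P T₁)      ≡⟨ cong (λ z → endpt H z (map P T₁)) pb ⟩
      endpt H (P b₀) (map P T₁)     ≡⟨ endpt-map X H P b₀ T₁ ⟩
      P (endpt X b₀ T₁)             ≡⟨ cong P (trans e₁ (sym e₂)) ⟩
      P (endpt X b₀ T₂)             ≡⟨ endpt-map X H P b₀ T₂ ⟨
      endpt H (P b₀) (map P T₂)     ∎
      where open ≡-Reasoning

  act-intro : ∀ {ψ b φ y z} → IsWalk X b₀ b ψ → IsWalk X b₀ y φ →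
              Lift b (drop 1 (map P φ)) z → Act U (map P ψ) y z
  act-intro {ψ = _ ∷ _} {φ = φ@(_ ∷ _)} wψ@(refl , _ , _) wφ l
    with lift-walk (lift-++ (walk-lifts wψ) l)
  ... | λ′ , wλ , eq = φ , λ′ , wφ , wλ , eq

  act-elim : ∀ {ψ b y z} → IsWalk X b₀ b ψ → Act U (map P ψ) y z →
             ∃[ φ ] (IsWalk X b₀ y φ × Lift b (drop 1 (map P φ)) z)
  act-elim {ψ = _ ∷ ψt} wψ@(refl , _ , _) (φ , λ′ , wφ , wλ , eq)
    with lift-split (map P ψt) (subst (λ s → Lift b₀ s _) (cong (drop 1) eq) (walk-lifts wλ))
  ... | m , b₀↝m , m↝z with lift-unique b₀↝m (walk-lifts wψ)
  ...   | refl = φ , wφ , m↝z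

  -- ϖ is the projection of a walk in the covering from the base point to k a.
  lifts-related-by-action : (A : Graph) (a : V A) → Connected A →
    (h k : V A → V X) → IsHom A X h → IsHom A X k → h a ≡ b₀ → (∀ x → P (h x) ≡ P (k x)) →
    ∃[ ϖ ] (IsWalk H w w ϖ × ∀ x z → (z ≡ k x) ⇔ Act U ϖ (h x) z)
  lifts-related-by-action A a conn h k h-hom k-hom ha≡b₀ Ph≗Pk with connected U b₀ (k a)
  ... | ψ , wψ = map P ψ , ϖ-closed , λ x z → mk⇔ (to x) (from x)
    where
    Pka≡Pb₀ : P (k a) ≡ P b₀
    Pka≡Pb₀ = trans (sym (Ph≗Pk a)) (cong P ha≡b₀)

    ϖ-closed : IsWalk H w w (map P ψ)
    ϖ-closed = subst₂ (λ s t → IsWalk H s t (map P ψ)) (p-base U) (trans Pka≡Pb₀ (p-base U))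
                      (walk-map X H P (Is2Covering.hom (covering U)) wψ)

    -- The image under h of a walk χ from a to x: its projection lifts from k a along k ∘ χ.
    reach : ∀ x → ∃[ φ ] (IsWalk X b₀ (h x) φ × Lift (k a) (drop 1 (map P φ)) (k x))
    reach x with conn a x
    ... | χ , wχ =
      map h χ ,
      subst (λ s → IsWalk X s (h x) (map h χ)) ha≡b₀ (walk-map A X h h-hom wχ) ,
      subst (λ s → Lift (k a) (drop 1 s) (k x)) (sym Ph∘χ≡Pk∘χ) (walk-lifts (walk-map A X k k-hom wχ))
      where
      Ph∘χ≡Pk∘χ : map P (map h χ) ≡ map P (map k χ)
      Ph∘χ≡Pk∘χ = trans (sym (map-∘ χ)) (trans (map-cong Ph≗Pk χ) (map-∘ χ))

    to : ∀ x {z} → z ≡ k x → Act U (map P ψ) (h x) z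
    to x refl with reach x
    ... | φ , wφ , l = act-intro wψ wφ l

    from : ∀ x {z} → Act U (map P ψ) (h x) z → z ≡ k x
    from x act with act-elim wψ act | reach x
    ... | φ , wφ , l | φ′ , wφ′ , l′ = projections-agree wφ wφ′ Pka≡Pb₀ l l′

lemma5p3 : (G H : Graph) →
    Finite G → Nonempty G → Connected G → HasEdge G →
    Finite H → Nonempty H → Connected H → HasEdge H →
    (f : V G → V H) → IsHom G H f → (v : V G) →
    (UG : Universal2Covering G v) → (UH : Universal2Covering H (f v)) →
    (f̃ : V (cov UG) → V (cov UH)) → IsHom (cov UG) (cov UH) f̃ →
    f̃ (base UG) ≡ base UH → (∀ x → p UH (f̃ x) ≡ f (p UG x)) →
    (g̃ : MultiMap (cov UG) (cov UH)) →
    InHomΓ f UG UH g̃ → SameComp f UG UH (singleton {cov UG} {cov UH} f̃) g̃ →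
    ProjectsTo f UG UH g̃ →
    ∃[ ϖ ] (IsWalk H (f v) (f v) ϖ ×
            (∀ x z → g̃ x z ⇔ Act UH ϖ (f̃ x) z))
lemma5p3 G H _ _ conn-G edge-G _ _ _ _ f _ v UG UH f̃ f̃-hom f̃-base f̃-lifts g̃ (g̃-multi , _) _ g̃-proj =
  let ϖ , ϖ-closed , act = deck in ϖ , ϖ-closed , λ x z → act x z ⇔-∘ g̃-graph x z
  where
  open UniversalLifting UH using (lifts-related-by-action)
  g : V (cov UG) → V (cov UH)
  g x = proj₁ (proj₁ g̃-multi x)
  g∈g̃ : ∀ x → g̃ x (g x)
  g∈g̃ x = proj₂ (proj₁ g̃-multi x)
  g-hom : IsHom (cov UG) (cov UH) g
  g-hom {x} {y} r = proj₂ g̃-multi x y (g x) (g y) r (g∈g̃ x) (g∈g̃ y)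
  g̃-graph : ∀ x z → g̃ x z ⇔ (z ≡ g x)
  g̃-graph x z = mk⇔ (λ g̃xz → single-valued g̃xz (g∈g̃ x)) (λ { refl → g∈g̃ x })
    where
    neighbour : ∃[ x′ ] _~_ (cov UG) x x′
    neighbour = covering-has-neighbour (covering UG) (has-neighbour G conn-G edge-G) x
    single-valued : ∀ {a a′} → g̃ x a → g̃ x a′ → a ≡ a′
    single-valued ga ga′ =
      multiHom-injective-on-fibres {A = cov UG} (covering UH) g̃ g̃-multi (proj₂ neighbour) ga ga′
        (trans (g̃-proj x _ ga) (sym (g̃-proj x _ ga′)))
  deck : ∃[ ϖ ] (IsWalk H (f v) (f v) ϖ × ∀ x z → (z ≡ g x) ⇔ Act UH ϖ (f̃ x) z)
  deck = lifts-related-by-action (cov UG) (base UG) (connected UG) f̃ g f̃-hom g-hom f̃-base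
           (λ x → trans (f̃-lifts x) (sym (g̃-proj x (g x) (g∈g̃ x))))
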